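{- For all $n\geq 0$, the number of desarrangements of length $n$ avoiding both $123$ and $132$ is \[ d_n(123,132)=\frac{2^{n+1}+(7-3n)(-1)^n}{9}. \]
   Context: Permutations are in one-line notation; $\mathfrak{S}_0$ consists of the empty permutation, which is considered a desarrangement. An index $i\in[n-1]$ is a descent of $\pi\in\mathfrak{S}_n$ if $\pi_i>\pi_{i+1}$; $i\in[n]$ is an ascent if it is not a descent (so $n$ is always an ascent). A desarrangement is a permutation whose first ascent is even. $d_n(\Pi)$ is the number of desarrangements in $\mathfrak{S}_n$ avoiding every pattern in $\Pi$ ($\pi$ avoids $\sigma$ if no subsequence of $\pi$ has the same relative order as $\sigma$). -}

module Defs where

open import Data.Bool using (Bool; true; false; _∧_; not; if_then_else_)
open import Data.Nat using (ℕ; zero; suc; _<ᵇ_; _≡ᵇ_; _%_)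
open import Data.List using (List; []; _∷_; map; concatMap; upTo; length; filterᵇ; zip; [_])
open import Data.Bool.ListAction using (all; any)
open import Data.Product using (_,_)

-- Permutations of [n] in one-line notation are represented as lists of
-- natural numbers: the lists of length n with entries in {1..n}, pairwise distinct.

listsOver : List ℕ → ℕ → List (List ℕ)
listsOver xs zero = [ [] ]
listsOver xs (suc k) = concatMap (λ x → map (x ∷_) (listsOver xs k)) xs

notElem : ℕ → List ℕ → Bool
notElem x ys = all (λ y → not (x ≡ᵇ y)) ys

distinct : List ℕ → Bool
distinct [] = true
distinct (x ∷ xs) = notElem x xs ∧ distinct xs

perms : ℕ → List (List ℕ)
perms n = filterᵇ distinct (listsOver (map suc (upTo n)) n)

subseqs : List ℕ → List (List ℕ)
subseqs [] = [ [] ]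
subseqs (x ∷ xs) = map (x ∷_) (subseqs xs) Data.List.++ subseqs xs

_==ᵇ_ : Bool → Bool → Bool
true ==ᵇ b = b
false ==ᵇ b = not b

-- same relative order (for sequences of distinct numbers):
-- same length, and for all i < j, a_i < a_j iff b_i < b_j
sameOrder : List ℕ → List ℕ → Bool
sameOrder [] [] = true
sameOrder [] (_ ∷ _) = false
sameOrder (_ ∷ _) [] = false
sameOrder (x ∷ xs) (y ∷ ys) =
  all (λ { (x' , y') → (x <ᵇ x') ==ᵇ (y <ᵇ y') }) (zip xs ys) ∧ sameOrder xs ys

contains : List ℕ → List ℕ → Bool
contains π σ = any (λ s → sameOrder s σ) (subseqs π)

avoidsAll : List (List ℕ) → List ℕ → Bool
avoidsAll Π π = all (λ σ → not (contains π σ)) Π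

-- first ascent (1-indexed); the last index n is always an ascent.
-- For the empty permutation we set it to 0 (even), so it is a desarrangement.
firstAscent : List ℕ → ℕ
firstAscent [] = 0
firstAscent (x ∷ []) = 1
firstAscent (x ∷ y ∷ r) = if x <ᵇ y then 1 else suc (firstAscent (y ∷ r))

isDesarrangement : List ℕ → Bool
isDesarrangement π = firstAscent π % 2 ≡ᵇ 0

d : ℕ → List (List ℕ) → ℕ
d n Π = length (filterᵇ (λ π → isDesarrangement π ∧ avoidsAll Π π) (perms n))

-- A permutation avoids 123 and 132 iff each entry has at most one larger entry
-- to its right.  So the first entry of such a permutation of [n] (n ≥ 2) is n or
-- n − 1, and deleting it and standardising leaves such a permutation of [n − 1];
-- conversely both choices of a first entry can be prepended to any avoider of
-- length n − 1.  There are therefore 2^(n−1) avoiders of length n ≥ 1.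
-- Prepending c to σ (raising the entries ≥ c by one) moves the first ascent of σ
-- one step to the right when the first entry of σ lies below c, and makes 1 an
-- ascent otherwise.  Writing a_n
-- for the number of desarrangements among the avoiders of length n and e_n for
-- the number of those σ for which prepending n gives a desarrangement, this yields
--   a_(n+1) = (2^(n−1) − a_n) + e_n,     e_(n+1) = 2^(n−1) − e_n,
-- and the closed form follows by induction.
module Submission where

open import Defs
open import Data.Nat using (ℕ; suc; _^_)
open import Data.Integer using (ℤ; +_; _+_; _-_; _*_; -[1+_])
open import Data.List using (List; []; _∷_)
open import Relation.Binary.PropositionalEquality using (_≡_)

open import Data.Bool using (Bool; true; false; T; T?; not; _∧_; if_then_else_)
open import Data.Bool.ListAction using (all; and; or)
open import Data.Bool.Properties using (T-≡; T-∧)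
open import Data.Empty using (⊥-elim)
import Data.Integer as ℤ
import Data.Integer.Properties as ℤ
open import Data.Integer.Tactic.RingSolver using (solve-∀)
open import Data.List as List using (map; zip; _++_; length; filter; filterᵇ; concatMap)
open import Data.List.Properties
  using (map-∘; map-++; map-cong; map-id-local; map-injective; length-map; length-++; length-upTo;
         length-filter; filter-++; ∷-injectiveˡ; ∷-injectiveʳ; ≡-dec)
open import Data.List.Membership.Propositional using (_∈_; find; lose)
open import Data.List.Membership.Propositional.Properties
  using (∈-++⁺ˡ; ∈-++⁺ʳ; ∈-++⁻; ∈-map⁺; ∈-map⁻; ∈-filter⁺; ∈-filter⁻; ∈-upTo⁺; ∈-upTo⁻;
         ∈-concatMap⁺; ∈-concatMap⁻)
open import Data.List.Membership.Propositional.Properties.WithK using (unique∧set⇒bag)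
open import Data.List.Relation.Binary.BagAndSetEquality using (∼bag⇒↭)
open import Data.List.Relation.Binary.Permutation.Propositional.Properties using (↭-length)
open import Data.List.Relation.Binary.Subset.Propositional using (_⊆_)
open import Data.List.Relation.Unary.All as All using (All; []; _∷_; tabulate; lookup)
import Data.List.Relation.Unary.All.Properties as AllP
open import Data.List.Relation.Unary.AllPairs using ([]; _∷_)
open import Data.List.Relation.Unary.Any using (here; there)
import Data.List.Relation.Unary.Any.Properties as AnyP
open import Data.List.Relation.Unary.Unique.Propositional using (Unique)
import Data.List.Relation.Unary.Unique.Propositional.Properties as UniqueP
open import Data.Nat as ℕ using (zero; _<ᵇ_; _≡ᵇ_; _<_; _≤_; z≤n; s≤s)
import Data.Nat.Properties as ℕ
open import Data.Product using (_×_; _,_; proj₁; proj₂; ∃; ∃₂)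
open import Data.Sum as Sum using (_⊎_; inj₁; inj₂)
open import Function using (_∘_; _⇔_; mk⇔; Equivalence)
open import Relation.Binary using (_Preserves_⟶_; tri<; tri≈; tri>)
open import Relation.Binary.Definitions using (DecidableEquality)
open import Relation.Binary.PropositionalEquality
  using (refl; sym; trans; cong; cong₂; subst; _≢_; module ≡-Reasoning)
open import Relation.Nullary using (¬_; contradiction; yes; no; ofʸ; ofⁿ)

<⇒<ᵇ≡true : ∀ {m n} → m < n → (m <ᵇ n) ≡ true
<⇒<ᵇ≡true m<n = Equivalence.to T-≡ (ℕ.<⇒<ᵇ m<n)

≥⇒<ᵇ≡false : ∀ {m n} → n ≤ m → (m <ᵇ n) ≡ false
≥⇒<ᵇ≡false {m} {zero} _ = refl
≥⇒<ᵇ≡false {suc m} {suc n} (s≤s n≤m) = ≥⇒<ᵇ≡false n≤m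

<ᵇ≡true⇒< : ∀ {m n} → (m <ᵇ n) ≡ true → m < n
<ᵇ≡true⇒< {m} {n} eq = ℕ.<ᵇ⇒< m n (Equivalence.from T-≡ eq)

T-not⁻ : ∀ {b} → T (not b) → ¬ T b
T-not⁻ {false} _ ()

T-not⁺ : ∀ {b} → ¬ T b → T (not b)
T-not⁺ {false} _ = _
T-not⁺ {true} ¬T = ¬T _

-- Strictly monotone relabellings

StrictlyMonotone : (ℕ → ℕ) → Set
StrictlyMonotone f = f Preserves _<_ ⟶ _<_

strictlyMonotone⇒injective : ∀ {f} → StrictlyMonotone f → ∀ {a b} → f a ≡ f b → a ≡ b
strictlyMonotone⇒injective mono {a} {b} fa≡fb with ℕ.<-cmp a b
... | tri< a<b _ _ = contradiction fa≡fb (ℕ.<⇒≢ (mono a<b))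
... | tri≈ _ a≡b _ = a≡b
... | tri> _ _ b<a = contradiction (sym fa≡fb) (ℕ.<⇒≢ (mono b<a))

strictlyMonotone⇒<ᵇ-invariant : ∀ {f} → StrictlyMonotone f → ∀ a b → (f a <ᵇ f b) ≡ (a <ᵇ b)
strictlyMonotone⇒<ᵇ-invariant {f} mono a b with ℕ.<-≤-connex a b
... | inj₁ a<b = trans (<⇒<ᵇ≡true (mono a<b)) (sym (<⇒<ᵇ≡true a<b))
... | inj₂ b≤a = trans (≥⇒<ᵇ≡false fb≤fa) (sym (≥⇒<ᵇ≡false b≤a))
  where
  fb≤fa : f b ≤ f a
  fb≤fa with ℕ.m≤n⇒m<n∨m≡n b≤a
  ... | inj₁ b<a = ℕ.<⇒≤ (mono b<a)
  ... | inj₂ refl = ℕ.≤-refl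

subseqs-map : ∀ f π → subseqs (map f π) ≡ map (map f) (subseqs π)
subseqs-map f [] = refl
subseqs-map f (x ∷ xs) = begin
  map (f x ∷_) (subseqs (map f xs)) ++ subseqs (map f xs)
    ≡⟨ cong (λ ss → map (f x ∷_) ss ++ ss) (subseqs-map f xs) ⟩
  map (f x ∷_) (map (map f) (subseqs xs)) ++ map (map f) (subseqs xs)
    ≡⟨ cong (_++ map (map f) (subseqs xs)) (trans (sym (map-∘ (subseqs xs))) (map-∘ (subseqs xs))) ⟩
  map (map f) (map (x ∷_) (subseqs xs)) ++ map (map f) (subseqs xs)
    ≡⟨ map-++ (map f) (map (x ∷_) (subseqs xs)) (subseqs xs) ⟨
  map (map f) (subseqs (x ∷ xs)) ∎
  where open ≡-Reasoning

module _ {f : ℕ → ℕ} (mono : StrictlyMonotone f) where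

  private
    <ᵇ-invariant : ∀ a b → (f a <ᵇ f b) ≡ (a <ᵇ b)
    <ᵇ-invariant = strictlyMonotone⇒<ᵇ-invariant mono

  sameOrder-map : ∀ s t → sameOrder (map f s) t ≡ sameOrder s t
  sameOrder-map [] [] = refl
  sameOrder-map [] (_ ∷ _) = refl
  sameOrder-map (_ ∷ _) [] = refl
  sameOrder-map (x ∷ xs) (y ∷ ys) = cong₂ _∧_ (comparisonsWithHead xs ys) (sameOrder-map xs ys)
    where
    comparisonsWithHead :
      ∀ xs ys → all (λ { (x′ , y′) → (f x <ᵇ x′) ==ᵇ (y <ᵇ y′) }) (zip (map f xs) ys)
              ≡ all (λ { (x′ , y′) → (x <ᵇ x′) ==ᵇ (y <ᵇ y′) }) (zip xs ys)
    comparisonsWithHead [] _ = refl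
    comparisonsWithHead (_ ∷ _) [] = refl
    comparisonsWithHead (x′ ∷ xs) (y′ ∷ ys) =
      cong₂ _∧_ (cong (_==ᵇ (y <ᵇ y′)) (<ᵇ-invariant x x′)) (comparisonsWithHead xs ys)

  contains-map : ∀ π σ → contains (map f π) σ ≡ contains π σ
  contains-map π σ = begin
    or (map (λ s → sameOrder s σ) (subseqs (map f π)))
      ≡⟨ cong (or ∘ map (λ s → sameOrder s σ)) (subseqs-map f π) ⟩
    or (map (λ s → sameOrder s σ) (map (map f) (subseqs π)))
      ≡⟨ cong or (map-∘ (subseqs π)) ⟨
    or (map (λ s → sameOrder (map f s) σ) (subseqs π))
      ≡⟨ cong or (map-cong (λ s → sameOrder-map s σ) (subseqs π)) ⟩
    contains π σ ∎
    where open ≡-Reasoning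

  avoidsAll-map : ∀ Π π → avoidsAll Π (map f π) ≡ avoidsAll Π π
  avoidsAll-map Π π = cong and (map-cong (λ σ → cong not (contains-map π σ)) Π)

  firstAscent-map : ∀ π → firstAscent (map f π) ≡ firstAscent π
  firstAscent-map [] = refl
  firstAscent-map (_ ∷ []) = refl
  firstAscent-map (x ∷ y ∷ π) =
    cong₂ (λ b k → if b then 1 else suc k) (<ᵇ-invariant x y) (firstAscent-map (y ∷ π))

-- Subsequences and pattern containment

module _ (x : ℕ) (τ : List ℕ) where

  ∷-∈-subseqs⁺ : ∀ {s} → s ∈ subseqs τ → (x ∷ s) ∈ subseqs (x ∷ τ)
  ∷-∈-subseqs⁺ s∈ = ∈-++⁺ˡ (∈-map⁺ (x ∷_) s∈)

  ∈-subseqs-∷⁺ : ∀ {s} → s ∈ subseqs τ → s ∈ subseqs (x ∷ τ)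
  ∈-subseqs-∷⁺ = ∈-++⁺ʳ (map (x ∷_) (subseqs τ))

  ∈-subseqs-∷⁻ : ∀ {s} → s ∈ subseqs (x ∷ τ) →
                 (∃ λ s′ → s ≡ x ∷ s′ × s′ ∈ subseqs τ) ⊎ s ∈ subseqs τ
  ∈-subseqs-∷⁻ s∈ with ∈-++⁻ (map (x ∷_) (subseqs τ)) s∈
  ... | inj₁ s∈map = inj₁ (let s′ , s′∈ , s≡ = ∈-map⁻ (x ∷_) s∈map in s′ , s≡ , s′∈)
  ... | inj₂ s∈τ = inj₂ s∈τ

[]∈subseqs : ∀ τ → [] ∈ subseqs τ
[]∈subseqs [] = here refl
[]∈subseqs (x ∷ τ) = ∈-subseqs-∷⁺ x τ ([]∈subseqs τ)

[-]∈subseqs : ∀ {b τ} → b ∈ τ → (b ∷ []) ∈ subseqs τ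
[-]∈subseqs {τ = x ∷ τ} (here refl) = ∷-∈-subseqs⁺ x τ ([]∈subseqs τ)
[-]∈subseqs {τ = x ∷ τ} (there b∈) = ∈-subseqs-∷⁺ x τ ([-]∈subseqs b∈)

pair∈subseqs : ∀ {a b τ} → a ∈ τ → b ∈ τ → a ≢ b →
               (a ∷ b ∷ []) ∈ subseqs τ ⊎ (b ∷ a ∷ []) ∈ subseqs τ
pair∈subseqs (here refl) (here refl) a≢b = contradiction refl a≢b
pair∈subseqs {τ = x ∷ τ} (here refl) (there b∈) _ = inj₁ (∷-∈-subseqs⁺ x τ ([-]∈subseqs b∈))
pair∈subseqs {τ = x ∷ τ} (there a∈) (here refl) _ = inj₂ (∷-∈-subseqs⁺ x τ ([-]∈subseqs a∈))
pair∈subseqs {τ = x ∷ τ} (there a∈) (there b∈) a≢b =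
  Sum.map (∈-subseqs-∷⁺ x τ) (∈-subseqs-∷⁺ x τ) (pair∈subseqs a∈ b∈ a≢b)

∈-subseqs⇒⊆ : ∀ {s τ} → s ∈ subseqs τ → s ⊆ τ
∈-subseqs⇒⊆ {τ = []} (here refl) ()
∈-subseqs⇒⊆ {τ = x ∷ τ} s∈ with ∈-subseqs-∷⁻ x τ s∈
... | inj₁ (s′ , refl , s′∈) = λ { (here refl)  → here refl
                                 ; (there y∈s′) → there (∈-subseqs⇒⊆ s′∈ y∈s′) }
... | inj₂ s∈τ = there ∘ ∈-subseqs⇒⊆ s∈τ

∈-subseqs⇒Unique : ∀ {s τ} → Unique τ → s ∈ subseqs τ → Unique s
∈-subseqs⇒Unique {τ = []} [] (here refl) = []
∈-subseqs⇒Unique {τ = x ∷ τ} (x∉τ ∷ uτ) s∈ with ∈-subseqs-∷⁻ x τ s∈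
... | inj₁ (s′ , refl , s′∈) = AllP.anti-mono (∈-subseqs⇒⊆ s′∈) x∉τ ∷ ∈-subseqs⇒Unique uτ s′∈
... | inj₂ s∈τ = ∈-subseqs⇒Unique uτ s∈τ

contains⁺ : ∀ π σ {s} → s ∈ subseqs π → T (sameOrder s σ) → T (contains π σ)
contains⁺ π σ s∈ matches = AnyP.any⁺ _ (lose s∈ matches)

contains⁻ : ∀ π σ → T (contains π σ) → ∃ λ s → s ∈ subseqs π × T (sameOrder s σ)
contains⁻ π σ occ = find (AnyP.any⁻ _ (subseqs π) occ)

avoidsAll⁺ : ∀ Π π → (∀ {σ} → σ ∈ Π → ¬ T (contains π σ)) → T (avoidsAll Π π)
avoidsAll⁺ Π π avoids = AllP.all⁻ _ (tabulate (T-not⁺ ∘ avoids))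

avoidsAll⁻ : ∀ Π π → T (avoidsAll Π π) → ∀ {σ} → σ ∈ Π → ¬ T (contains π σ)
avoidsAll⁻ Π π av σ∈Π = T-not⁻ (lookup (AllP.all⁺ _ Π av) σ∈Π)

avoidsAll-∷⁻ : ∀ Π c τ → T (avoidsAll Π (c ∷ τ)) → T (avoidsAll Π τ)
avoidsAll-∷⁻ Π c τ av = avoidsAll⁺ Π τ λ {σ} σ∈Π occ →
  let _ , s∈ , matches = contains⁻ τ σ occ
  in avoidsAll⁻ Π (c ∷ τ) av σ∈Π (contains⁺ (c ∷ τ) σ (∈-subseqs-∷⁺ c τ s∈) matches)

sameOrder⇒length≡ : ∀ s t → T (sameOrder s t) → length s ≡ length t
sameOrder⇒length≡ [] [] _ = refl
sameOrder⇒length≡ (x ∷ s) (y ∷ t) h =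
  cong suc (sameOrder⇒length≡ s t (proj₂ (Equivalence.to T-∧ h)))

-- Avoiding 123 and 132

σ₁₂₃ σ₁₃₂ : List ℕ
σ₁₂₃ = 1 ∷ 2 ∷ 3 ∷ []
σ₁₃₂ = 1 ∷ 3 ∷ 2 ∷ []

Π : List (List ℕ)
Π = σ₁₂₃ ∷ σ₁₃₂ ∷ []

Avoids : List ℕ → Set
Avoids π = T (avoidsAll Π π)

AtMostOneAbove : ℕ → List ℕ → Set
AtMostOneAbove c τ = ∀ {a b} → a ∈ τ → b ∈ τ → c < a → c < b → a ≡ b

sameOrder-minFirst⇒twoAbove :
  ∀ c s {y z} → T (sameOrder (c ∷ s) (1 ∷ suc (suc y) ∷ suc (suc z) ∷ [])) →
  ∃₂ λ a b → s ≡ a ∷ b ∷ [] × c < a × c < b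
sameOrder-minFirst⇒twoAbove c [] ()
sameOrder-minFirst⇒twoAbove c s@(_ ∷ []) {y} {z} h =
  contradiction (sameOrder⇒length≡ (c ∷ s) (1 ∷ suc (suc y) ∷ suc (suc z) ∷ []) h) λ ()
sameOrder-minFirst⇒twoAbove c s@(_ ∷ _ ∷ _ ∷ _) {y} {z} h =
  contradiction (sameOrder⇒length≡ (c ∷ s) (1 ∷ suc (suc y) ∷ suc (suc z) ∷ []) h) λ ()
sameOrder-minFirst⇒twoAbove c (a ∷ b ∷ []) h with c <ᵇ a in c<ᵇa | c <ᵇ b in c<ᵇb
... | true | true = a , b , refl , <ᵇ≡true⇒< c<ᵇa , <ᵇ≡true⇒< c<ᵇb
... | true | false = ⊥-elim h
... | false | _ = ⊥-elim h

sameOrder₁₂₃ : ∀ {c x y} → c < x → x < y → T (sameOrder (c ∷ x ∷ y ∷ []) σ₁₂₃)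
sameOrder₁₂₃ c<x x<y
  rewrite <⇒<ᵇ≡true c<x | <⇒<ᵇ≡true (ℕ.<-trans c<x x<y) | <⇒<ᵇ≡true x<y = _

sameOrder₁₃₂ : ∀ {c x y} → c < y → y ≤ x → T (sameOrder (c ∷ x ∷ y ∷ []) σ₁₃₂)
sameOrder₁₃₂ c<y y≤x
  rewrite <⇒<ᵇ≡true (ℕ.<-≤-trans c<y y≤x) | <⇒<ᵇ≡true c<y | ≥⇒<ᵇ≡false y≤x = _

avoids-∷⁺ : ∀ {c τ} → Unique τ → Avoids τ → AtMostOneAbove c τ → Avoids (c ∷ τ)
avoids-∷⁺ {c} {τ} uτ av atMostOne = avoidsAll⁺ Π (c ∷ τ) λ {σ} σ∈Π occ →
  let s , s∈ , matches = contains⁻ (c ∷ τ) σ occ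
  in noOccurrence (∈-subseqs-∷⁻ c τ s∈) σ∈Π matches
  where
  -- sameOrder does not see ties (c ∷ a ∷ a ∷ [] matches 132), hence the need for Unique τ.
  noneAtHead : ∀ {s y z} → s ∈ subseqs τ →
               ¬ T (sameOrder (c ∷ s) (1 ∷ suc (suc y) ∷ suc (suc z) ∷ []))
  noneAtHead {s} s∈ matches with sameOrder-minFirst⇒twoAbove c s matches
  ... | a , b , refl , c<a , c<b with ∈-subseqs⇒Unique uτ s∈
  ...   | (a≢b ∷ []) ∷ _ =
    a≢b (atMostOne (∈-subseqs⇒⊆ s∈ (here refl)) (∈-subseqs⇒⊆ s∈ (there (here refl))) c<a c<b)
  noOccurrence : ∀ {s σ} → (∃ λ s′ → s ≡ c ∷ s′ × s′ ∈ subseqs τ) ⊎ s ∈ subseqs τ →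
                 σ ∈ Π → ¬ T (sameOrder s σ)
  noOccurrence (inj₁ (_ , refl , s′∈)) (here refl) = noneAtHead s′∈
  noOccurrence (inj₁ (_ , refl , s′∈)) (there (here refl)) = noneAtHead s′∈
  noOccurrence {σ = σ} (inj₂ s∈τ) σ∈Π matches = avoidsAll⁻ Π τ av σ∈Π (contains⁺ τ σ s∈τ matches)

¬avoids-pairAbove : ∀ {c τ x y} → (x ∷ y ∷ []) ∈ subseqs τ → c < x → c < y → ¬ Avoids (c ∷ τ)
¬avoids-pairAbove {c} {τ} {x} {y} xy∈ c<x c<y av with ℕ.<-≤-connex x y
... | inj₁ x<y = avoidsAll⁻ Π (c ∷ τ) av (here refl)
  (contains⁺ (c ∷ τ) σ₁₂₃ (∷-∈-subseqs⁺ c τ xy∈) (sameOrder₁₂₃ c<x x<y))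
... | inj₂ y≤x = avoidsAll⁻ Π (c ∷ τ) av (there (here refl))
  (contains⁺ (c ∷ τ) σ₁₃₂ (∷-∈-subseqs⁺ c τ xy∈) (sameOrder₁₃₂ c<y y≤x))

¬avoids-twoAbove : ∀ {c τ a b} → a ∈ τ → b ∈ τ → a ≢ b → c < a → c < b → ¬ Avoids (c ∷ τ)
¬avoids-twoAbove {c} {τ} a∈ b∈ a≢b c<a c<b with pair∈subseqs a∈ b∈ a≢b
... | inj₁ ab∈ = ¬avoids-pairAbove {c} {τ} ab∈ c<a c<b
... | inj₂ ba∈ = ¬avoids-pairAbove {c} {τ} ba∈ c<b c<a

-- Permutations

module _ {A : Set} (_≟_ : DecidableEquality A) where

  open import Data.List.Membership.DecPropositional _≟_ using (_∈?_)

  unique-⇔-length-≡ : ∀ {xs ys : List A} → Unique xs → Unique ys →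
                      (∀ {z} → z ∈ xs ⇔ z ∈ ys) → length xs ≡ length ys
  unique-⇔-length-≡ uxs uys same = ↭-length (∼bag⇒↭ (unique∧set⇒bag uxs uys same))

  unique-⊆-length-≤ : ∀ {xs ys : List A} → Unique xs → Unique ys → xs ⊆ ys → length xs ≤ length ys
  unique-⊆-length-≤ {xs} {ys} uxs uys xs⊆ys = begin
    length xs                   ≡⟨ unique-⇔-length-≡ uxs (UniqueP.filter⁺ (_∈? xs) uys) same ⟩
    length (filter (_∈? xs) ys) ≤⟨ length-filter (_∈? xs) ys ⟩
    length ys                   ∎
    where
    open ℕ.≤-Reasoning
    same : ∀ {z} → z ∈ xs ⇔ z ∈ filter (_∈? xs) ys
    same = mk⇔ (λ z∈xs → ∈-filter⁺ (_∈? xs) (xs⊆ys z∈xs) z∈xs)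
               (proj₂ ∘ ∈-filter⁻ (_∈? xs) {xs = ys})

  unique-⊆-length-≥⇒⊇ : ∀ {xs ys : List A} → Unique xs → Unique ys → xs ⊆ ys →
                        length ys ≤ length xs → ys ⊆ xs
  unique-⊆-length-≥⇒⊇ {xs} {ys} uxs uys xs⊆ys ys≤xs {v} v∈ys with v ∈? xs
  ... | yes v∈xs = v∈xs
  ... | no v∉xs = contradiction (unique-⊆-length-≤ (v≢xs ∷ uxs) uys v∷xs⊆ys) (ℕ.≤⇒≯ ys≤xs)
    where
    v≢xs : All (v ≢_) xs
    v≢xs = tabulate λ y∈xs v≡y → v∉xs (subst (_∈ xs) (sym v≡y) y∈xs)
    v∷xs⊆ys : (v ∷ xs) ⊆ ys
    v∷xs⊆ys (here refl) = v∈ys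
    v∷xs⊆ys (there y∈xs) = xs⊆ys y∈xs

range : ℕ → List ℕ
range n = map suc (List.upTo n)

∈-range⁺ : ∀ {n v} → 0 < v → v ≤ n → v ∈ range n
∈-range⁺ {v = suc v} _ v≤n = ∈-map⁺ suc (∈-upTo⁺ v≤n)

∈-range⁻ : ∀ {n v} → v ∈ range n → 0 < v × v ≤ n
∈-range⁻ v∈ with ∈-map⁻ suc v∈
... | _ , i∈ , refl = s≤s z≤n , ∈-upTo⁻ i∈

range-unique : ∀ n → Unique (range n)
range-unique n = UniqueP.map⁺ ℕ.suc-injective (UniqueP.upTo⁺ n)

length-range : ∀ n → length (range n) ≡ n
length-range n = trans (length-map suc (List.upTo n)) (length-upTo n)

∈-listsOver⁻ : ∀ A k {xs} → xs ∈ listsOver A k → length xs ≡ k × All (_∈ A) xs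
∈-listsOver⁻ A zero (here refl) = refl , []
∈-listsOver⁻ A (suc k) xs∈ with find (∈-concatMap⁻ (λ x → map (x ∷_) (listsOver A k)) {xs = A} xs∈)
... | x , x∈A , xs∈map with ∈-map⁻ (x ∷_) xs∈map
...   | w , w∈ , refl = let length≡ , w⊆A = ∈-listsOver⁻ A k w∈ in cong suc length≡ , x∈A ∷ w⊆A

∈-listsOver⁺ : ∀ A k {xs} → length xs ≡ k → All (_∈ A) xs → xs ∈ listsOver A k
∈-listsOver⁺ A zero {[]} refl [] = here refl
∈-listsOver⁺ A (suc k) {x ∷ xs} length≡ (x∈A ∷ xs⊆A) =
  ∈-concatMap⁺ (λ x → map (x ∷_) (listsOver A k))
    (lose x∈A (∈-map⁺ (x ∷_) (∈-listsOver⁺ A k (ℕ.suc-injective length≡) xs⊆A)))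

listsOver-unique : ∀ {A} k → Unique A → Unique (listsOver A k)
listsOver-unique zero _ = [] ∷ []
listsOver-unique {A} (suc k) uA = extend uA
  where
  L = listsOver A k
  extend : ∀ {B} → Unique B → Unique (concatMap (λ x → map (x ∷_) L) B)
  extend [] = []
  extend {a ∷ B} (a∉B ∷ uB) =
    UniqueP.++⁺ (UniqueP.map⁺ ∷-injectiveʳ (listsOver-unique k uA)) (extend uB) disjoint
    where
    disjoint : ∀ {v} → ¬ (v ∈ map (a ∷_) L × v ∈ concatMap (λ x → map (x ∷_) L) B)
    disjoint (v∈₁ , v∈₂)
      with ∈-map⁻ (a ∷_) v∈₁ | find (∈-concatMap⁻ (λ x → map (x ∷_) L) {xs = B} v∈₂)
    ... | _ , _ , refl | x , x∈B , v∈₃ with ∈-map⁻ (x ∷_) v∈₃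
    ...   | _ , _ , refl = lookup a∉B x∈B refl

notElem⇒All≢ : ∀ x ys → T (notElem x ys) → All (x ≢_) ys
notElem⇒All≢ x ys h = All.map (λ {y} t x≡y → T-not⁻ t (ℕ.≡⇒≡ᵇ x y x≡y)) (AllP.all⁺ _ ys h)

All≢⇒notElem : ∀ x ys → All (x ≢_) ys → T (notElem x ys)
All≢⇒notElem x ys x∉ys = AllP.all⁻ _ (All.map (λ {y} x≢y → T-not⁺ (x≢y ∘ ℕ.≡ᵇ⇒≡ x y)) x∉ys)

distinct⇒Unique : ∀ xs → T (distinct xs) → Unique xs
distinct⇒Unique [] _ = []
distinct⇒Unique (x ∷ xs) h =
  let x∉xs , uxs = Equivalence.to T-∧ h in notElem⇒All≢ x xs x∉xs ∷ distinct⇒Unique xs uxs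

Unique⇒distinct : ∀ xs → Unique xs → T (distinct xs)
Unique⇒distinct [] _ = _
Unique⇒distinct (x ∷ xs) (x∉xs ∷ uxs) =
  Equivalence.from T-∧ (All≢⇒notElem x xs x∉xs , Unique⇒distinct xs uxs)

IsPerm : ℕ → List ℕ → Set
IsPerm n π = length π ≡ n × All (_∈ range n) π × Unique π

∈-perms⁻ : ∀ {n π} → π ∈ perms n → IsPerm n π
∈-perms⁻ {n} {π} π∈ =
  let π∈L , d = ∈-filter⁻ (T? ∘ distinct) {xs = listsOver (range n) n} π∈
      length≡ , π⊆ = ∈-listsOver⁻ (range n) n π∈L
  in length≡ , π⊆ , distinct⇒Unique π d

∈-perms⁺ : ∀ {n π} → IsPerm n π → π ∈ perms n
∈-perms⁺ {n} {π} (length≡ , π⊆ , uπ) =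
  ∈-filter⁺ (T? ∘ distinct) (∈-listsOver⁺ (range n) n length≡ π⊆) (Unique⇒distinct π uπ)

perms-unique : ∀ n → Unique (perms n)
perms-unique n = UniqueP.filter⁺ (T? ∘ distinct) (listsOver-unique n (range-unique n))

IsPerm⇒range⊆ : ∀ {n π} → IsPerm n π → range n ⊆ π
IsPerm⇒range⊆ {n} {π} (length≡ , π⊆ , uπ) =
  unique-⊆-length-≥⇒⊇ ℕ._≟_ uπ (range-unique n) (lookup π⊆)
    (ℕ.≤-reflexive (trans (length-range n) (sym length≡)))

-- Prepending a first entry

-- shift c is the order isomorphism from ℕ onto ℕ ∖ {c}; unshift c is its inverse on ℕ ∖ {c}.
shift : ℕ → ℕ → ℕ
shift c v = if v <ᵇ c then v else suc v

unshift : ℕ → ℕ → ℕ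
unshift c v = if v <ᵇ c then v else ℕ.pred v

shift-< : ∀ {c v} → v < c → shift c v ≡ v
shift-< v<c rewrite <⇒<ᵇ≡true v<c = refl

shift-≥ : ∀ {c v} → c ≤ v → shift c v ≡ suc v
shift-≥ c≤v rewrite ≥⇒<ᵇ≡false c≤v = refl

shift-strictlyMonotone : ∀ c → StrictlyMonotone (shift c)
shift-strictlyMonotone c {a} {b} a<b
  with a <ᵇ c | ℕ.<ᵇ-reflects-< a c | b <ᵇ c | ℕ.<ᵇ-reflects-< b c
... | true | _ | true | _ = a<b
... | true | _ | false | _ = ℕ.m<n⇒m<1+n a<b
... | false | ofⁿ a≮c | true | ofʸ b<c = contradiction (ℕ.<-trans a<b b<c) a≮c
... | false | _ | false | _ = s≤s a<b

shift-≢ : ∀ c v → shift c v ≢ c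
shift-≢ c v with v <ᵇ c | ℕ.<ᵇ-reflects-< v c
... | true | ofʸ v<c = ℕ.<⇒≢ v<c
... | false | ofⁿ v≮c = λ v+1≡c → v≮c (ℕ.≤-reflexive v+1≡c)

shift-unshift : ∀ c v → v ≢ c → shift c (unshift c v) ≡ v
shift-unshift c v v≢c with v <ᵇ c in v<ᵇc | ℕ.<ᵇ-reflects-< v c
... | true | _ rewrite v<ᵇc = refl
... | false | ofⁿ v≮c with v
...   | zero = contradiction (ℕ.n≤0⇒n≡0 (ℕ.≮⇒≥ v≮c)) (v≢c ∘ sym)
...   | suc w with w <ᵇ c | ℕ.<ᵇ-reflects-< w c
...     | true | ofʸ w<c = contradiction (ℕ.≤-antisym w<c (ℕ.≮⇒≥ v≮c)) v≢c
...     | false | _ = refl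

shift-range : ∀ {N c v} → v ∈ range N → shift c v ∈ range (suc N)
shift-range {N} {c} {v} v∈ with ∈-range⁻ v∈ | v <ᵇ c
... | 0<v , v≤N | true = ∈-range⁺ 0<v (ℕ.m≤n⇒m≤1+n v≤N)
... | _ , v≤N | false = ∈-range⁺ (s≤s z≤n) (s≤s v≤N)

unshift-range : ∀ {N c v} → c ∈ range (suc N) → v ≢ c → v ∈ range (suc N) → unshift c v ∈ range N
unshift-range {N} {c} {v} c∈ v≢c v∈ with ∈-range⁻ c∈ | ∈-range⁻ v∈ | v <ᵇ c | ℕ.<ᵇ-reflects-< v c
... | _ , c≤N+1 | 0<v , _ | true | ofʸ v<c = ∈-range⁺ 0<v (ℕ.≤-pred (ℕ.<-≤-trans v<c c≤N+1))
... | 0<c , _ | _ , v≤N+1 | false | ofⁿ v≮c with v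
...   | suc w = ∈-range⁺ (ℕ.<-≤-trans 0<c c≤w) (ℕ.≤-pred v≤N+1)
  where
  c≤w : c ≤ w
  c≤w = ℕ.≤-pred (ℕ.≤∧≢⇒< (ℕ.≮⇒≥ v≮c) (v≢c ∘ sym))

prepend : ℕ → List ℕ → List ℕ
prepend c σ = c ∷ map (shift c) σ

prepend-IsPerm : ∀ {N c σ} → c ∈ range (suc N) → IsPerm N σ → IsPerm (suc N) (prepend c σ)
prepend-IsPerm {N} {c} {σ} c∈ (length≡ , σ⊆ , uσ) =
  cong suc (trans (length-map (shift c) σ) length≡) ,
  c∈ ∷ AllP.map⁺ (All.map (shift-range {c = c}) σ⊆) ,
  AllP.map⁺ (All.universal (λ v c≡ → shift-≢ c v (sym c≡)) σ) ∷
    UniqueP.map⁺ (strictlyMonotone⇒injective (shift-strictlyMonotone c)) uσ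

bounded⇒atMostOneAbove : ∀ {c τ} → All (_≤ suc c) τ → AtMostOneAbove c τ
bounded⇒atMostOneAbove τ≤ a∈ b∈ c<a c<b =
  trans (ℕ.≤-antisym (lookup τ≤ a∈) c<a) (sym (ℕ.≤-antisym (lookup τ≤ b∈) c<b))

prepend-Avoids : ∀ {N c σ} → N ≤ c → IsPerm N σ → Avoids σ → Avoids (prepend c σ)
prepend-Avoids {N} {c} {σ} N≤c (_ , σ⊆ , uσ) av =
  avoids-∷⁺ (UniqueP.map⁺ (strictlyMonotone⇒injective mono) uσ)
            (subst T (sym (avoidsAll-map mono Π σ)) av)
            (bounded⇒atMostOneAbove (AllP.map⁺ (All.map bound σ⊆)))
  where
  mono = shift-strictlyMonotone c
  bound : ∀ {v} → v ∈ range N → shift c v ≤ suc c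
  bound v∈ = ℕ.≤-trans (proj₂ (∈-range⁻ (shift-range {c = c} v∈))) (s≤s N≤c)

unprepend : ∀ {N c τ} → IsPerm (suc N) (c ∷ τ) →
            IsPerm N (map (unshift c) τ) × prepend c (map (unshift c) τ) ≡ c ∷ τ
unprepend {N} {c} {τ} (length≡ , c∈ ∷ τ⊆ , c∉τ ∷ uτ) = σ-perm , cong (c ∷_) shift∘unshift
  where
  shift∘unshift : map (shift c) (map (unshift c) τ) ≡ τ
  shift∘unshift =
    trans (sym (map-∘ τ)) (map-id-local (All.map (λ c≢v → shift-unshift c _ (c≢v ∘ sym)) c∉τ))
  σ-perm : IsPerm N (map (unshift c) τ)
  σ-perm = trans (length-map (unshift c) τ) (ℕ.suc-injective length≡) ,
           AllP.map⁺ (tabulate λ v∈ → unshift-range c∈ (lookup c∉τ v∈ ∘ sym) (lookup τ⊆ v∈)) ,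
           UniqueP.map⁻ (subst Unique (sym shift∘unshift) uτ)

avoider-head≥ : ∀ {n c τ} → IsPerm (suc (suc n)) (c ∷ τ) → Avoids (c ∷ τ) → suc n ≤ c
avoider-head≥ {n} {c} {τ} π-perm av with ℕ.<-≤-connex c (suc n)
... | inj₂ n+1≤c = n+1≤c
... | inj₁ c<n+1 =
  contradiction av
    (¬avoids-twoAbove n+1∈τ n+2∈τ (ℕ.<⇒≢ (ℕ.n<1+n (suc n))) c<n+1 (ℕ.m<n⇒m<1+n c<n+1))
  where
  inTail : ∀ {v} → v ∈ range (suc (suc n)) → c < v → v ∈ τ
  inTail v∈ c<v with IsPerm⇒range⊆ π-perm v∈
  ... | here refl = contradiction c<v (ℕ.<-irrefl refl)
  ... | there v∈τ = v∈τ
  n+1∈τ = inTail (∈-range⁺ (s≤s z≤n) (ℕ.n≤1+n (suc n))) c<n+1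
  n+2∈τ = inTail (∈-range⁺ (s≤s z≤n) ℕ.≤-refl) (ℕ.m<n⇒m<1+n c<n+1)

avoiders : ℕ → List (List ℕ)
avoiders zero = [] ∷ []
avoiders (suc zero) = (1 ∷ []) ∷ []
avoiders (suc (suc n)) =
  map (prepend (suc (suc n))) (avoiders (suc n)) ++ map (prepend (suc n)) (avoiders (suc n))

∈-avoiders⁻ : ∀ {n π} → π ∈ avoiders (suc (suc n)) →
              ∃ λ σ → σ ∈ avoiders (suc n) × (π ≡ prepend (suc (suc n)) σ ⊎ π ≡ prepend (suc n) σ)
∈-avoiders⁻ {n} π∈ with ∈-++⁻ (map (prepend (suc (suc n))) (avoiders (suc n))) π∈
... | inj₁ π∈₁ = let σ , σ∈ , π≡ = ∈-map⁻ (prepend (suc (suc n))) π∈₁ in σ , σ∈ , inj₁ π≡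
... | inj₂ π∈₂ = let σ , σ∈ , π≡ = ∈-map⁻ (prepend (suc n)) π∈₂ in σ , σ∈ , inj₂ π≡

∈-avoiders⁺ : ∀ {n c σ} → σ ∈ avoiders (suc n) → c ≡ suc (suc n) ⊎ c ≡ suc n →
              prepend c σ ∈ avoiders (suc (suc n))
∈-avoiders⁺ {n} σ∈ (inj₁ refl) = ∈-++⁺ˡ (∈-map⁺ (prepend (suc (suc n))) σ∈)
∈-avoiders⁺ {n} σ∈ (inj₂ refl) =
  ∈-++⁺ʳ (map (prepend (suc (suc n))) (avoiders (suc n))) (∈-map⁺ (prepend (suc n)) σ∈)

prepend-sound : ∀ {N c σ} → suc N ≤ c → c ≤ suc (suc N) → IsPerm (suc N) σ × Avoids σ →
                IsPerm (suc (suc N)) (prepend c σ) × Avoids (prepend c σ)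
prepend-sound N+1≤c c≤N+2 (σ-perm , σ-avoids) =
  prepend-IsPerm (∈-range⁺ (ℕ.<-≤-trans (s≤s z≤n) N+1≤c) c≤N+2) σ-perm ,
  prepend-Avoids N+1≤c σ-perm σ-avoids

avoiders-sound-step : ∀ {n π} → (∀ {σ} → σ ∈ avoiders (suc n) → IsPerm (suc n) σ × Avoids σ) →
                      π ∈ avoiders (suc (suc n)) → IsPerm (suc (suc n)) π × Avoids π
avoiders-sound-step {n} ih π∈ with ∈-avoiders⁻ {n} π∈
... | σ , σ∈ , inj₁ refl = prepend-sound (ℕ.n≤1+n (suc n)) ℕ.≤-refl (ih σ∈)
... | σ , σ∈ , inj₂ refl = prepend-sound ℕ.≤-refl (ℕ.n≤1+n (suc n)) (ih σ∈)

avoiders-sound : ∀ n {π} → π ∈ avoiders n → IsPerm n π × Avoids π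
avoiders-sound zero (here refl) = (refl , [] , []) , _
avoiders-sound (suc zero) (here refl) = (refl , ∈-range⁺ (s≤s z≤n) (s≤s z≤n) ∷ [] , [] ∷ []) , _
avoiders-sound (suc (suc n)) = avoiders-sound-step (avoiders-sound (suc n))

avoiders-complete-step : ∀ {n π} → (∀ {σ} → IsPerm (suc n) σ → Avoids σ → σ ∈ avoiders (suc n)) →
                         IsPerm (suc (suc n)) π → Avoids π → π ∈ avoiders (suc (suc n))
avoiders-complete-step {n} {c ∷ τ} ih π-perm@(_ , c∈ ∷ _ , _) av =
  subst (_∈ avoiders (suc (suc n))) π≡ (∈-avoiders⁺ (ih σ-perm σ-avoids) c≡n+2⊎c≡n+1)
  where
  σ = map (unshift c) τ
  σ-perm = proj₁ (unprepend π-perm)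
  π≡ = proj₂ (unprepend π-perm)
  σ-avoids : Avoids σ
  σ-avoids = subst T (avoidsAll-map (shift-strictlyMonotone c) Π σ)
                   (subst (T ∘ avoidsAll Π) (sym (∷-injectiveʳ π≡)) (avoidsAll-∷⁻ Π c τ av))
  c≡n+2⊎c≡n+1 : c ≡ suc (suc n) ⊎ c ≡ suc n
  c≡n+2⊎c≡n+1 with ℕ.m≤n⇒m<n∨m≡n (proj₂ (∈-range⁻ c∈))
  ... | inj₁ c<n+2 = inj₂ (ℕ.≤-antisym (ℕ.≤-pred c<n+2) (avoider-head≥ π-perm av))
  ... | inj₂ c≡n+2 = inj₁ c≡n+2

avoiders-complete : ∀ n {π} → IsPerm n π → Avoids π → π ∈ avoiders n
avoiders-complete zero {[]} _ _ = here refl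
avoiders-complete (suc zero) {c ∷ []} (_ , c∈ ∷ [] , _) _
  with refl ← ℕ.≤-antisym (proj₂ (∈-range⁻ c∈)) (proj₁ (∈-range⁻ c∈)) = here refl
avoiders-complete (suc (suc n)) = avoiders-complete-step (avoiders-complete (suc n))

avoiders-unique : ∀ n → Unique (avoiders n)
avoiders-unique zero = [] ∷ []
avoiders-unique (suc zero) = [] ∷ []
avoiders-unique (suc (suc n)) =
  UniqueP.++⁺ (UniqueP.map⁺ prepend-injective (avoiders-unique (suc n)))
              (UniqueP.map⁺ prepend-injective (avoiders-unique (suc n)))
              firstEntries-differ
  where
  prepend-injective : ∀ {c σ σ′} → prepend c σ ≡ prepend c σ′ → σ ≡ σ′
  prepend-injective {c} eq =
    map-injective (strictlyMonotone⇒injective (shift-strictlyMonotone c)) (∷-injectiveʳ eq)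
  firstEntries-differ : ∀ {π} → ¬ (π ∈ map (prepend (suc (suc n))) (avoiders (suc n)) ×
                                   π ∈ map (prepend (suc n)) (avoiders (suc n)))
  firstEntries-differ (π∈₁ , π∈₂)
    with ∈-map⁻ (prepend (suc (suc n))) π∈₁ | ∈-map⁻ (prepend (suc n)) π∈₂
  ... | _ , _ , refl | _ , _ , eq = ℕ.<-irrefl (sym (∷-injectiveˡ eq)) (ℕ.n<1+n (suc n))

-- Counting desarrangements

count : ∀ {A : Set} → (A → Bool) → List A → ℕ
count p xs = length (filterᵇ p xs)

count-++ : ∀ {A : Set} (p : A → Bool) xs ys → count p (xs ++ ys) ≡ count p xs ℕ.+ count p ys
count-++ p xs ys = trans (cong length (filter-++ (T? ∘ p) xs ys)) (length-++ (filterᵇ p xs))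

count-map : ∀ {A B : Set} (p : B → Bool) (q : A → Bool) (f : A → B) xs →
            (∀ {x} → x ∈ xs → p (f x) ≡ q x) → count p (map f xs) ≡ count q xs
count-map p q f [] _ = refl
count-map p q f (x ∷ xs) agree with p (f x) | q x | agree (here refl)
... | true | true | refl = cong suc (count-map p q f xs (agree ∘ there))
... | false | false | refl = count-map p q f xs (agree ∘ there)

count-const-false : ∀ {A : Set} (xs : List A) → count (λ _ → false) xs ≡ 0
count-const-false [] = refl
count-const-false (_ ∷ xs) = count-const-false xs

count+count-not : ∀ {A : Set} (p : A → Bool) xs → count p xs ℕ.+ count (not ∘ p) xs ≡ length xs
count+count-not p [] = refl
count+count-not p (x ∷ xs) with p x
... | true = cong suc (count+count-not p xs)
... | false = trans (ℕ.+-suc _ _) (cong suc (count+count-not p xs))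

desCount prependDesCount : ℕ → ℕ
desCount n = count isDesarrangement (avoiders n)
prependDesCount n = count (isDesarrangement ∘ prepend n) (avoiders n)

d≡desCount : ∀ n → d n Π ≡ desCount n
d≡desCount n = unique-⇔-length-≡ (≡-dec ℕ._≟_)
  (UniqueP.filter⁺ (T? ∘ desAvoids) (perms-unique n))
  (UniqueP.filter⁺ (T? ∘ isDesarrangement) (avoiders-unique n))
  (mk⇔ to from)
  where
  desAvoids : List ℕ → Bool
  desAvoids π = isDesarrangement π ∧ avoidsAll Π π
  to : ∀ {π} → π ∈ filterᵇ desAvoids (perms n) → π ∈ filterᵇ isDesarrangement (avoiders n)
  to π∈ with ∈-filter⁻ (T? ∘ desAvoids) {xs = perms n} π∈
  ... | π∈perms , des∧av with Equivalence.to T-∧ des∧av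
  ...   | des , av =
    ∈-filter⁺ (T? ∘ isDesarrangement) (avoiders-complete n (∈-perms⁻ π∈perms) av) des
  from : ∀ {π} → π ∈ filterᵇ isDesarrangement (avoiders n) → π ∈ filterᵇ desAvoids (perms n)
  from π∈ with ∈-filter⁻ (T? ∘ isDesarrangement) {xs = avoiders n} π∈
  ... | π∈avoiders , des with avoiders-sound n π∈avoiders
  ...   | π-perm , av =
    ∈-filter⁺ (T? ∘ desAvoids) (∈-perms⁺ π-perm) (Equivalence.from T-∧ (des , av))

parity-suc : ∀ k → (suc k ℕ.% 2 ≡ᵇ 0) ≡ not (k ℕ.% 2 ≡ᵇ 0)
parity-suc zero = refl
parity-suc (suc zero) = refl
parity-suc (suc (suc k)) = parity-suc k

isDesarrangement-prepend-< : ∀ {c y} r → y < c →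
                             isDesarrangement (prepend c (y ∷ r)) ≡ not (isDesarrangement (y ∷ r))
isDesarrangement-prepend-< {c} {y} r y<c = begin
  isDesarrangement (prepend c (y ∷ r))
    ≡⟨ cong (λ b → (if b then 1 else suc (firstAscent (map (shift c) (y ∷ r)))) ℕ.% 2 ≡ᵇ 0) noAscent ⟩
  (suc (firstAscent (map (shift c) (y ∷ r))) ℕ.% 2 ≡ᵇ 0)
    ≡⟨ cong (λ k → suc k ℕ.% 2 ≡ᵇ 0) (firstAscent-map (shift-strictlyMonotone c) (y ∷ r)) ⟩
  (suc (firstAscent (y ∷ r)) ℕ.% 2 ≡ᵇ 0)
    ≡⟨ parity-suc (firstAscent (y ∷ r)) ⟩
  not (isDesarrangement (y ∷ r)) ∎
  where
  open ≡-Reasoning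
  noAscent : (c <ᵇ shift c y) ≡ false
  noAscent rewrite shift-< y<c = ≥⇒<ᵇ≡false (ℕ.<⇒≤ y<c)

isDesarrangement-prepend-≥ : ∀ {c y} r → c ≤ y → isDesarrangement (prepend c (y ∷ r)) ≡ false
isDesarrangement-prepend-≥ r c≤y rewrite shift-≥ c≤y | <⇒<ᵇ≡true (s≤s c≤y) = refl

length-avoiders : ∀ m → length (avoiders (suc m)) ≡ 2 ^ m
length-avoiders zero = refl
length-avoiders (suc m) = begin
  length (map (prepend m+2) Av ++ map (prepend m+1) Av)
    ≡⟨ length-++ (map (prepend m+2) Av) ⟩
  length (map (prepend m+2) Av) ℕ.+ length (map (prepend m+1) Av)
    ≡⟨ cong₂ ℕ._+_ (length-map (prepend m+2) Av) (length-map (prepend m+1) Av) ⟩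
  length Av ℕ.+ length Av
    ≡⟨ cong (λ k → k ℕ.+ k) (length-avoiders m) ⟩
  2 ^ m ℕ.+ 2 ^ m
    ≡⟨ cong (2 ^ m ℕ.+_) (ℕ.+-identityʳ (2 ^ m)) ⟨
  2 ^ suc m ∎
  where
  open ≡-Reasoning
  m+1 = suc m
  m+2 = suc (suc m)
  Av = avoiders m+1

avoiders-head : ∀ {m σ} → σ ∈ avoiders (suc m) → ∃₂ λ y r → σ ≡ y ∷ r × y < suc (suc m)
avoiders-head {m} σ∈ with avoiders-sound (suc m) σ∈
... | (_ , y∈ ∷ _ , _) , _ = _ , _ , refl , s≤s (proj₂ (∈-range⁻ y∈))

desCount-step : ∀ m → desCount (suc (suc m)) ≡
                count (not ∘ isDesarrangement) (avoiders (suc m)) ℕ.+ prependDesCount (suc m)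
desCount-step m =
  trans (count-++ isDesarrangement (map (prepend m+2) Av) (map (prepend m+1) Av))
        (cong₂ ℕ._+_ (count-map isDesarrangement (not ∘ isDesarrangement) (prepend m+2) Av flips)
                     (count-map isDesarrangement (isDesarrangement ∘ prepend m+1) (prepend m+1) Av λ _ → refl))
  where
  m+1 = suc m
  m+2 = suc (suc m)
  Av = avoiders m+1
  flips : ∀ {σ} → σ ∈ Av → isDesarrangement (prepend m+2 σ) ≡ not (isDesarrangement σ)
  flips σ∈ with avoiders-head {m} σ∈
  ... | _ , r , refl , y<m+2 = isDesarrangement-prepend-< r y<m+2

prependDesCount-step : ∀ m → prependDesCount (suc (suc m)) ≡
                       count (not ∘ isDesarrangement ∘ prepend (suc m)) (avoiders (suc m))
prependDesCount-step m = begin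
  count P (map (prepend m+2) Av ++ map (prepend m+1) Av)
    ≡⟨ count-++ P (map (prepend m+2) Av) (map (prepend m+1) Av) ⟩
  count P (map (prepend m+2) Av) ℕ.+ count P (map (prepend m+1) Av)
    ≡⟨ cong₂ ℕ._+_ (count-map P (λ _ → false) (prepend m+2) Av λ {σ} _ →
                      isDesarrangement-prepend-≥ {m+2} (map (shift m+2) σ) ℕ.≤-refl)
                   (count-map P Q (prepend m+1) Av λ {σ} _ →
                      isDesarrangement-prepend-< {m+2} (map (shift m+1) σ) (ℕ.n<1+n m+1)) ⟩
  count (λ _ → false) Av ℕ.+ count Q Av
    ≡⟨ cong (ℕ._+ count Q Av) (count-const-false Av) ⟩
  count Q Av ∎
  where
  open ≡-Reasoning
  m+1 = suc m
  m+2 = suc (suc m)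
  Av = avoiders m+1
  P = isDesarrangement ∘ prepend m+2
  Q = not ∘ isDesarrangement ∘ prepend m+1

-- Solving the recurrences

x+y≡z⇒y≡z-x : ∀ {x y z : ℤ} → x + y ≡ z → y ≡ z - x
x+y≡z⇒y≡z-x {x} {y} x+y≡z = trans (cancel x y) (cong (_- x) x+y≡z)
  where
  cancel : ∀ x y → y ≡ (x + y) - x
  cancel = solve-∀

-- With p = 2^m and s = (−1)^(m+1): a and e are desCount and prependDesCount at m + 1,
-- o = p − a and k = p − e are the complementary counts, and by the recurrences
-- o + e and k are desCount and prependDesCount at m + 2.
closedForm-step : ∀ {a o e k p s n : ℤ} → a + o ≡ p → e + k ≡ p →
                  + 9 * a ≡ + 4 * p + (+ 7 - + 3 * n) * s → + 3 * e ≡ p + s →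
                  + 9 * (o + e) ≡ + 4 * (+ 2 * p) + (+ 7 - + 3 * (+ 1 + n)) * (-[1+ 0 ] * s) ×
                  + 3 * k ≡ + 2 * p + -[1+ 0 ] * s
closedForm-step {a} {o} {e} {k} {p} {s} {n} a+o≡p e+k≡p 9a≡ 3e≡ = 9[o+e]≡ , 3k≡
  where
  open ≡-Reasoning
  9[o+e]≡ : + 9 * (o + e) ≡ + 4 * (+ 2 * p) + (+ 7 - + 3 * (+ 1 + n)) * (-[1+ 0 ] * s)
  9[o+e]≡ = begin
    + 9 * (o + e)                                             ≡⟨ cong (λ u → + 9 * (u + e)) (x+y≡z⇒y≡z-x a+o≡p) ⟩
    + 9 * (p - a + e)                                         ≡⟨ expand p a e ⟩
    + 9 * p + + 3 * (+ 3 * e) - + 9 * a                       ≡⟨ cong₂ (λ u v → + 9 * p + + 3 * u - v) 3e≡ 9a≡ ⟩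
    + 9 * p + + 3 * (p + s) - (+ 4 * p + (+ 7 - + 3 * n) * s) ≡⟨ collect p s n ⟩
    + 4 * (+ 2 * p) + (+ 7 - + 3 * (+ 1 + n)) * (-[1+ 0 ] * s) ∎
    where
    expand : ∀ p a e → + 9 * (p - a + e) ≡ + 9 * p + + 3 * (+ 3 * e) - + 9 * a
    expand = solve-∀
    collect : ∀ p s n → + 9 * p + + 3 * (p + s) - (+ 4 * p + (+ 7 - + 3 * n) * s) ≡
                        + 4 * (+ 2 * p) + (+ 7 - + 3 * (+ 1 + n)) * (-[1+ 0 ] * s)
    collect = solve-∀
  3k≡ : + 3 * k ≡ + 2 * p + -[1+ 0 ] * s
  3k≡ = begin
    + 3 * k                ≡⟨ cong (+ 3 *_) (x+y≡z⇒y≡z-x e+k≡p) ⟩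
    + 3 * (p - e)          ≡⟨ expand p e ⟩
    + 3 * p - + 3 * e      ≡⟨ cong (λ u → + 3 * p - u) 3e≡ ⟩
    + 3 * p - (p + s)      ≡⟨ collect p s ⟩
    + 2 * p + -[1+ 0 ] * s ∎
    where
    expand : ∀ p e → + 3 * (p - e) ≡ + 3 * p - + 3 * e
    expand = solve-∀
    collect : ∀ p s → + 3 * p - (p + s) ≡ + 2 * p + -[1+ 0 ] * s
    collect = solve-∀

closedForm : ∀ m →
  + 9 * + desCount (suc m) ≡ + 4 * + (2 ^ m) + (+ 7 - + 3 * + suc m) * -[1+ 0 ] ℤ.^ suc m ×
  + 3 * + prependDesCount (suc m) ≡ + (2 ^ m) + -[1+ 0 ] ℤ.^ suc m
closedForm zero = refl , refl
closedForm (suc m) with closedForm m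
... | 9a≡ , 3e≡ = 9a′≡ , 3e′≡
  where
  open ≡-Reasoning
  s = -[1+ 0 ] ℤ.^ suc m
  N = count (not ∘ isDesarrangement) (avoiders (suc m))
  K = count (not ∘ isDesarrangement ∘ prepend (suc m)) (avoiders (suc m))
  complements : ∀ (p : List ℕ → Bool) →
                + count p (avoiders (suc m)) + + count (not ∘ p) (avoiders (suc m)) ≡ + (2 ^ m)
  complements p =
    trans (sym (ℤ.pos-+ (count p (avoiders (suc m))) (count (not ∘ p) (avoiders (suc m)))))
          (cong +_ (trans (count+count-not p (avoiders (suc m))) (length-avoiders m)))
  steps = closedForm-step {+ desCount (suc m)} {+ N} {+ prependDesCount (suc m)} {+ K}
                          {+ (2 ^ m)} {s} {+ suc m}
            (complements isDesarrangement) (complements (isDesarrangement ∘ prepend (suc m))) 9a≡ 3e≡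
  2^m+1≡ : + 2 * + (2 ^ m) ≡ + (2 ^ suc m)
  2^m+1≡ = sym (ℤ.pos-* 2 (2 ^ m))
  9a′≡ : + 9 * + desCount (suc (suc m)) ≡
         + 4 * + (2 ^ suc m) + (+ 7 - + 3 * + suc (suc m)) * (-[1+ 0 ] * s)
  9a′≡ = begin
    + 9 * + desCount (suc (suc m))
      ≡⟨ cong (λ k → + 9 * + k) (desCount-step m) ⟩
    + 9 * + (N ℕ.+ prependDesCount (suc m))
      ≡⟨ cong (+ 9 *_) (ℤ.pos-+ N (prependDesCount (suc m))) ⟩
    + 9 * (+ N + + prependDesCount (suc m))
      ≡⟨ proj₁ steps ⟩
    + 4 * (+ 2 * + (2 ^ m)) + (+ 7 - + 3 * + suc (suc m)) * (-[1+ 0 ] * s)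
      ≡⟨ cong (λ p → + 4 * p + (+ 7 - + 3 * + suc (suc m)) * (-[1+ 0 ] * s)) 2^m+1≡ ⟩
    + 4 * + (2 ^ suc m) + (+ 7 - + 3 * + suc (suc m)) * (-[1+ 0 ] * s) ∎
  3e′≡ : + 3 * + prependDesCount (suc (suc m)) ≡ + (2 ^ suc m) + -[1+ 0 ] * s
  3e′≡ = begin
    + 3 * + prependDesCount (suc (suc m)) ≡⟨ cong (λ k → + 3 * + k) (prependDesCount-step m) ⟩
    + 3 * + K                            ≡⟨ proj₂ steps ⟩
    + 2 * + (2 ^ m) + -[1+ 0 ] * s       ≡⟨ cong (_+ -[1+ 0 ] * s) 2^m+1≡ ⟩
    + (2 ^ suc m) + -[1+ 0 ] * s         ∎

theorem3p19 : (n : ℕ) →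
    + 9 * + d n ((1 ∷ 2 ∷ 3 ∷ []) ∷ (1 ∷ 3 ∷ 2 ∷ []) ∷ [])
      ≡ + (2 ^ suc n) + (+ 7 - + 3 * + n) * (-[1+ 0 ] Data.Integer.^ n)
theorem3p19 zero = refl
theorem3p19 (suc m) = begin
  + 9 * + d (suc m) Π
    ≡⟨ cong (λ k → + 9 * + k) (d≡desCount (suc m)) ⟩
  + 9 * + desCount (suc m)
    ≡⟨ proj₁ (closedForm m) ⟩
  + 4 * + (2 ^ m) + (+ 7 - + 3 * + suc m) * -[1+ 0 ] ℤ.^ suc m
    ≡⟨ cong (λ p → p + (+ 7 - + 3 * + suc m) * -[1+ 0 ] ℤ.^ suc m) 4*2^m≡ ⟩
  + (2 ^ suc (suc m)) + (+ 7 - + 3 * + suc m) * -[1+ 0 ] ℤ.^ suc m ∎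
  where
  open ≡-Reasoning
  4*2^m≡ : + 4 * + (2 ^ m) ≡ + (2 ^ suc (suc m))
  4*2^m≡ = trans (sym (ℤ.pos-* 4 (2 ^ m))) (cong +_ (ℕ.*-assoc 2 2 (2 ^ m)))
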